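{- Let $(P,\preceq, \psi)$ be a pillar assignment of an interval system $\mathcal{I}$ with $\omega(\mathcal{I})=\omega$, let $K$ be an arch such that $d(K)\ge \omega$, and let $\mathcal{J}$ be a collection of pairwise disjoint open intervals contained within $K$ such that $|\mathcal{J}| \ge \omega$. Then \[\sum_{J\in \mathcal{J}}d(J) \le \omega\big(d(K) +|\mathcal{J}| - \omega \big),\] where $d=d_{(P,\preceq,\psi)}$.
   Context: An interval system is a finite collection $\mathcal I$ of open intervals contained in $(0,1)$ such that no two share an endpoint. For an interval $I$, $\ell(I)$, $r(I)$ are its left and right endpoints. Two distinct intervals overlap if they intersect and neither contains the other. For a set $\mathcal X$ of intervals, $\omega(\mathcal X)$ is the maximum size of a subset of pairwise overlapping intervals ($0$ if empty). A proper partial colouring of $\mathcal I$ is a map from a subset of $\mathcal I$ to the positive integers giving no two overlapping intervals the same colour. Structured colourings: if $\mathcal X\subseteq\mathcal I$ is a set of intervals all containing a common point and $C$ is a set of positive integers with $|C|=\omega(\mathcal X)$, a proper colouring $\phi:\mathcal X\to C$ is structured if (i) whenever $I_1,\dots,I_k\in\mathcal X$ satisfy $\phi(I_1)<\dots<\phi(I_k)$ and $\ell(I_1)<\dots<\ell(I_k)$, there are $k$ pairwise overlapping $I_1^*,\dots,I_k^*\in\mathcal X$ with all $\ell(I_j^*)\in[\ell(I_1),\ell(I_k)]$, and (ii) the same holds with $r$ in place of $\ell$ throughout. A pillar of $\mathcal I$ is a point of $(0,1)$ that is not an endpoint of any interval of $\mathcal I$. Let $P$ be a finite set of pillars totally ordered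 by $\preceq$. An interval $I\in\mathcal I$ is assigned to $p\in P$ if $p\in I$ and $I$ contains no $p'\in P$ with $p'\prec p$; $\mathcal I_p$ is the set of intervals assigned to $p$. The foundation $F_p$ is the open interval containing $p$, with endpoints in $\{p'\in P:p'\prec p\}\cup\{0,1\}$, containing no pillar $p'\prec p$; $\mathcal F_p$ is the set of intervals of $\mathcal I$ with exactly one endpoint in $F_p$. A pillar assignment is a triple $(P,\preceq,\psi)$ with $\psi=\bigcup_{p\in P}\phi_p$, where in $\preceq$-order, with $\psi_{\prec p}=\bigcup_{p'\prec p}\phi_{p'}$, $C_p$ is the set of the $\omega(\mathcal I_p)$ smallest positive integers not in $\psi_{\prec p}(\mathcal F_p)$ and $\phi_p:\mathcal I_p\to C_p$ is a structured colouring. An arch of $(P,\preceq,\psi)$ is an open interval whose endpoints lie in $\{0,1\}\cup P$ and which contains no pillar of $P$. For an open interval $J$ contained in an arch, the degree $d_{(P,\preceq,\psi)}(J)$ is the number of distinct colours $\psi(I)$ taken over the intervals $I\in\mathcal I$ coloured by $\psi$ that have an endpoint in $J$.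
   Formalization: The endpoints of the intervals of $\mathcal I$, of the arch $K$ and of the members of $\mathcal{J}$, as well as the pillars, are rational numbers. -}

module Defs where

open import Data.Nat as ℕ using (ℕ; zero; suc)
open import Data.Fin as Fin using (Fin; fromℕ)
open import Data.Rational using (ℚ; 0ℚ; 1ℚ) renaming (_<_ to _<ℚ_; _≤_ to _≤ℚ_)
open import Data.List using (List; length; map; allFin)
open import Data.Nat.ListAction using (sum)
open import Data.List.Membership.Propositional using (_∈_)
open import Data.List.Relation.Unary.All using (All)
open import Data.List.Relation.Unary.AllPairs using (AllPairs)
open import Data.List.Relation.Unary.Unique.Propositional using (Unique)
open import Data.Maybe using (Maybe; just)
open import Data.Product using (Σ; ∃; _×_; _,_)
open import Data.Sum using (_⊎_)
open import Relation.Nullary using (¬_)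
open import Data.Empty using (⊥)
open import Relation.Binary.PropositionalEquality using (_≡_; _≢_)

-- Points are rationals.  All notions are invariant under order-isomorphism,
-- and every finite configuration of reals is order-isomorphic to one of rationals.

record Interval : Set where
  constructor ⟨_,_∣_⟩
  field
    lo : ℚ
    hi : ℚ
    lo<hi : lo <ℚ hi
open Interval public

_∈⟨_,_⟩ : ℚ → ℚ → ℚ → Set
x ∈⟨ a , b ⟩ = (a <ℚ x) × (x <ℚ b)

_∈ᴵ_ : ℚ → Interval → Set
x ∈ᴵ I = x ∈⟨ lo I , hi I ⟩

Intersect : Interval → Interval → Set
Intersect I J = ∃ λ x → (x ∈ᴵ I) × (x ∈ᴵ J)

_⊆ᴵ_ : Interval → Interval → Set
I ⊆ᴵ J = ∀ x → x ∈ᴵ I → x ∈ᴵ J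

Overlap : Interval → Interval → Set
Overlap I J = Intersect I J × ¬ (I ⊆ᴵ J) × ¬ (J ⊆ᴵ I)

IsIntervalSystem : ∀ {n} → (Fin n → Interval) → Set
IsIntervalSystem {n} 𝓘 =
  (∀ i → (0ℚ ≤ℚ lo (𝓘 i)) × (hi (𝓘 i) ≤ℚ 1ℚ)) ×
  (∀ i j → i ≢ j →
     (lo (𝓘 i) ≢ lo (𝓘 j)) × (lo (𝓘 i) ≢ hi (𝓘 j)) ×
     (hi (𝓘 i) ≢ lo (𝓘 j)) × (hi (𝓘 i) ≢ hi (𝓘 j)))

module _ {n : ℕ} (𝓘 : Fin n → Interval) where

  Clique : (Fin n → Set) → List (Fin n) → Set
  Clique X L = All X L × AllPairs (λ i j → Overlap (𝓘 i) (𝓘 j)) L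

  IsOmega : (Fin n → Set) → ℕ → Set
  IsOmega X w = (Σ (List (Fin n)) λ L → Clique X L × length L ≡ w) ×
                (∀ L → Clique X L → length L ℕ.≤ w)

  -- condition (i)/(ii) of structured colourings, for the endpoint map e
  StructuredAt : (Interval → ℚ) → (Fin n → Set) → (Fin n → Maybe ℕ) → Set
  StructuredAt e X ψ =
    ∀ k (I : Fin (suc k) → Fin n) (c : Fin (suc k) → ℕ) →
    (∀ j → X (I j)) → (∀ j → ψ (I j) ≡ just (c j)) →
    (∀ j j' → j Fin.< j' → (c j ℕ.< c j') × (e (𝓘 (I j)) <ℚ e (𝓘 (I j')))) →
    Σ (Fin (suc k) → Fin n) λ J →
      (∀ j → X (J j)) ×
      (∀ j j' → j ≢ j' → Overlap (𝓘 (J j)) (𝓘 (J j'))) ×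
      (∀ j → (e (𝓘 (I Fin.zero)) ≤ℚ e (𝓘 (J j))) × (e (𝓘 (J j)) ≤ℚ e (𝓘 (I (fromℕ k)))))

  -- ψ restricted to X is a structured colouring X → C
  -- (|C| = ω(X) is imposed where C is chosen)
  Structured : (Fin n → Set) → List ℕ → (Fin n → Maybe ℕ) → Set
  Structured X C ψ =
    (∀ i → X i → ∃ λ c → (ψ i ≡ just c) × (c ∈ C)) ×
    (∀ i j c → X i → X j → Overlap (𝓘 i) (𝓘 j) → ψ i ≡ just c → ψ j ≡ just c → ⊥) ×
    StructuredAt lo X ψ ×
    StructuredAt hi X ψ

-- Pillars.  P : Fin m → ℚ is injective and ⪯ is the index order on Fin m
-- (every total order on a finite set is of this form).

module _ {n : ℕ} (𝓘 : Fin n → Interval) {m : ℕ} (P : Fin m → ℚ) where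

  IsPillarSet : Set
  IsPillarSet =
    (∀ k k' → P k ≡ P k' → k ≡ k') ×
    (∀ k → (0ℚ <ℚ P k) × (P k <ℚ 1ℚ) ×
           (∀ i → (P k ≢ lo (𝓘 i)) × (P k ≢ hi (𝓘 i))))

  Assigned : Fin m → Fin n → Set
  Assigned k i = (P k ∈ᴵ 𝓘 i) × (∀ k' → k' Fin.< k → ¬ (P k' ∈ᴵ 𝓘 i))

  EarlierOr01 : Fin m → ℚ → Set
  EarlierOr01 k x = (x ≡ 0ℚ) ⊎ (x ≡ 1ℚ) ⊎ (∃ λ k' → (k' Fin.< k) × (P k' ≡ x))

  IsFoundation : Fin m → ℚ → ℚ → Set
  IsFoundation k a b =
    EarlierOr01 k a × EarlierOr01 k b × (P k ∈⟨ a , b ⟩) ×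
    (∀ k' → k' Fin.< k → ¬ (P k' ∈⟨ a , b ⟩))

  InFoundationSet : Fin m → Fin n → Set
  InFoundationSet k i = ∃ λ a → ∃ λ b → IsFoundation k a b ×
    (((lo (𝓘 i) ∈⟨ a , b ⟩) × ¬ (hi (𝓘 i) ∈⟨ a , b ⟩)) ⊎
     (¬ (lo (𝓘 i) ∈⟨ a , b ⟩) × (hi (𝓘 i) ∈⟨ a , b ⟩)))

  UsedBefore : (Fin n → Maybe ℕ) → Fin m → ℕ → Set
  UsedBefore ψ k c = ∃ λ i → InFoundationSet k i ×
    (∃ λ k' → (k' Fin.< k) × Assigned k' i) × (ψ i ≡ just c)

  IsSmallestAvoiding : (ℕ → Set) → ℕ → List ℕ → Set
  IsSmallestAvoiding S w C =
    Unique C × (length C ≡ w) × All (λ c → (1 ℕ.≤ c) × ¬ S c) C ×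
    (∀ d c → 1 ℕ.≤ d → ¬ S d → c ∈ C → d ℕ.< c → d ∈ C)

  IsPillarAssignment : (Fin n → Maybe ℕ) → Set
  IsPillarAssignment ψ =
    (∀ i c → ψ i ≡ just c → ∃ λ k → Assigned k i) ×
    (∀ k → ∃ λ w → IsOmega 𝓘 (Assigned k) w ×
       Σ (List ℕ) λ C → IsSmallestAvoiding (UsedBefore ψ k) w C ×
                        Structured 𝓘 (Assigned k) C ψ)

  IsArch : ℚ → ℚ → Set
  IsArch a b =
    (a <ℚ b) ×
    ((a ≡ 0ℚ) ⊎ (a ≡ 1ℚ) ⊎ (∃ λ k → P k ≡ a)) ×
    ((b ≡ 0ℚ) ⊎ (b ≡ 1ℚ) ⊎ (∃ λ k → P k ≡ b)) ×
    (∀ k → ¬ (P k ∈⟨ a , b ⟩))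

HasCard : (ℕ → Set) → ℕ → Set
HasCard S d = Σ (List ℕ) λ L → Unique L × (∀ c → c ∈ L → S c) ×
                               (∀ c → S c → c ∈ L) × (length L ≡ d)

HasDegree : ∀ {n} → (Fin n → Interval) → (Fin n → Maybe ℕ) → Interval → ℕ → Set
HasDegree 𝓘 ψ J d =
  HasCard (λ c → ∃ λ i → (ψ i ≡ just c) × ((lo (𝓘 i) ∈ᴵ J) ⊎ (hi (𝓘 i) ∈ᴵ J))) d

sumFin : ∀ {t} → (Fin t → ℕ) → ℕ
sumFin {t} f = sum (map f (allFin t))

module Submission where

-- Order the intervals of 𝓙 from left to right, and the colours seen by K by the key
-- (side of K of the colour's pillar, position of that pillar, colour).  A colour seen by K
-- determines its pillar: K lies in the foundation of every pillar carrying an interval that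
-- meets K, so that pillar's colours avoid those of earlier pillars' intervals meeting K.
-- Each colour counted in d(J) then yields the cell (rank of J, rank of the colour) of a
-- t × d(K) grid, distinct incidences yielding distinct cells.  A chain of ω + 1 cells
-- increasing in both coordinates would give ω + 1 pairwise overlapping intervals: within one
-- pillar by the structured property of its colouring, across pillars because the order of
-- the keys forces the intervals to interleave.  A set of grid cells without such a chain has
-- at most ω (t + d(K) − ω) elements.

open import Defs
open import Data.Nat using (ℕ)
open import Data.Fin using (Fin)
open import Data.Rational using (ℚ)
open import Data.Maybe using (Maybe)

module ListLemmas where

  open import Data.Nat.Base using (suc; _+_; _∸_; _≤_; _<_; z≤n; s≤s)
  open import Data.Nat.Properties
    using (_≟_; m≤n⇒m≤1+n; +-suc; m+[n∸m]≡n; m+n∸m≡n; ∸-monoˡ-<; ≤⇒≯; <⇒≯; <⇒≢;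
           module ≤-Reasoning)
  open import Data.Nat.ListAction using (sum)
  open import Data.List.Base using (List; []; _∷_; _++_; length; map; concat; filter; applyUpTo; lookup)
  open import Data.List.Properties using (filter-notAll; length-applyUpTo; length-++)
  open import Data.List.Membership.Propositional using (_∈_; mapWith∈)
  open import Data.List.Membership.Propositional.Properties
    using (∈-filter⁺; ∈-applyUpTo⁺; ∈-lookup; mapWith∈≗map)
  open import Data.List.Relation.Unary.Any as Any using (here; there)
  import Data.List.Relation.Unary.Any.Properties as Any
  open import Data.List.Relation.Unary.All as All using (All; []; _∷_)
  import Data.List.Relation.Unary.All.Properties as All
  open import Data.List.Relation.Unary.AllPairs using (AllPairs; []; _∷_)
  open import Data.List.Relation.Unary.Linked using (Linked; []; [-]; _∷_)
  open import Data.List.Relation.Unary.Unique.Propositional using (Unique)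
  open import Data.List.Relation.Binary.Subset.Propositional using (_⊆_)
  open import Data.Fin.Base as Fin using ()
  open import Data.Product using (_×_; _,_)
  open import Function using (_∘_)
  open import Level using (Level)
  open import Relation.Nullary using (¬_; yes; no; ¬?; contradiction)
  open import Relation.Unary using (Pred; Decidable)
  open import Relation.Binary using (Rel; DecidableEquality; StrictTotalOrder; tri<; tri≈; tri>)
  open import Relation.Binary.PropositionalEquality using (_≡_; refl; trans; cong; subst; ≢-sym)

  private
    variable
      a b p q r s : Level

  module _ {A : Set a} where

    module _ {P : Pred A p} {Q : Pred A q} (P? : Decidable P) (Q? : Decidable Q)
             (P⊆Q : ∀ {x} → P x → Q x) where

      length-filter-mono : ∀ xs → length (filter P? xs) ≤ length (filter Q? xs)
      length-filter-mono [] = z≤n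
      length-filter-mono (x ∷ xs) with P? x | Q? x
      ... | yes _  | yes _  = s≤s (length-filter-mono xs)
      ... | yes px | no ¬qx = contradiction (P⊆Q px) ¬qx
      ... | no _   | yes _  = m≤n⇒m≤1+n (length-filter-mono xs)
      ... | no _   | no _   = length-filter-mono xs

      length-filter-strictMono : ∀ {xs v} → v ∈ xs → Q v → ¬ P v →
                                 length (filter P? xs) < length (filter Q? xs)
      length-filter-strictMono {x ∷ xs} v∈ qv ¬pv with P? x | Q? x
      length-filter-strictMono {x ∷ xs} (here refl) qv ¬pv | yes px | _      = contradiction px ¬pv
      length-filter-strictMono {x ∷ xs} (there v∈)  qv ¬pv | yes _  | yes _  =
        s≤s (length-filter-strictMono v∈ qv ¬pv)
      length-filter-strictMono {x ∷ xs} _           qv ¬pv | yes px | no ¬qx = contradiction (P⊆Q px) ¬qx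
      length-filter-strictMono {x ∷ xs} _           qv ¬pv | no _   | yes _  = s≤s (length-filter-mono xs)
      length-filter-strictMono {x ∷ xs} (here refl) qv ¬pv | no _   | no ¬qx = contradiction qv ¬qx
      length-filter-strictMono {x ∷ xs} (there v∈)  qv ¬pv | no _   | no _   =
        length-filter-strictMono v∈ qv ¬pv

    length-filter-+-∁ : {P : Pred A p} (P? : Decidable P) → ∀ xs →
                        length (filter P? xs) + length (filter (¬? ∘ P?) xs) ≡ length xs
    length-filter-+-∁ P? [] = refl
    length-filter-+-∁ P? (x ∷ xs) with P? x
    ... | yes _ = cong suc (length-filter-+-∁ P? xs)
    ... | no _  = trans (+-suc _ _) (cong suc (length-filter-+-∁ P? xs))

    length-concat : ∀ (xss : List (List A)) → length (concat xss) ≡ sum (map length xss)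
    length-concat [] = refl
    length-concat (xs ∷ xss) = trans (length-++ xs) (cong (length xs +_) (length-concat xss))

    Unique-⊆⇒length≤ : DecidableEquality A → ∀ {xs ys} → Unique xs → xs ⊆ ys → length xs ≤ length ys
    Unique-⊆⇒length≤ _≟_ {[]} _ _ = z≤n
    Unique-⊆⇒length≤ _≟_ {x ∷ xs} {ys} (x∉xs ∷ xs!) xs⊆ys = begin
      suc (length xs)   ≤⟨ s≤s (Unique-⊆⇒length≤ _≟_ xs! xs⊆ys′) ⟩
      suc (length ys′)  ≤⟨ filter-notAll (¬? ∘ (x ≟_)) ys
                             (Any.map (λ x≡y x≢y → x≢y x≡y) (xs⊆ys (here refl))) ⟩
      length ys         ∎
      where
      open ≤-Reasoning
      ys′ = filter (¬? ∘ (x ≟_)) ys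
      xs⊆ys′ : xs ⊆ ys′
      xs⊆ys′ z∈ = ∈-filter⁺ (¬? ∘ (x ≟_)) (xs⊆ys (there z∈)) (All.lookup x∉xs z∈)

    Unique-mapWith∈ : ∀ {B : Set b} {xs : List A} (f : ∀ {x} → x ∈ xs → B) → Unique xs →
                      (∀ {x y} (x∈ : x ∈ xs) (y∈ : y ∈ xs) → f x∈ ≡ f y∈ → x ≡ y) →
                      Unique (mapWith∈ xs f)
    Unique-mapWith∈ {xs = []} f _ _ = []
    Unique-mapWith∈ {xs = x ∷ xs} f (x∉xs ∷ xs!) f-inj =
      All.tabulate (λ v∈ fx≡v → let y , y∈ , v≡fy = Any.mapWith∈⁻ xs (f ∘ there) v∈
                                in All.lookup x∉xs y∈ (f-inj (here refl) (there y∈) (trans fx≡v v≡fy)))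
      ∷ Unique-mapWith∈ (f ∘ there) xs! (λ x∈ y∈ → f-inj (there x∈) (there y∈))

    Unique-map⁺ : ∀ {B : Set b} {xs : List A} (f : A → B) → Unique xs →
                  (∀ {x y} → x ∈ xs → y ∈ xs → f x ≡ f y → x ≡ y) → Unique (map f xs)
    Unique-map⁺ {xs = xs} f xs! f-inj =
      subst Unique (mapWith∈≗map f xs) (Unique-mapWith∈ (λ {x} _ → f x) xs! f-inj)

    Linked-mapWith∈ : ∀ {B : Set b} {R : Rel A r} {S : Rel B s} {xs : List A} (f : ∀ {x} → x ∈ xs → B) →
                      (∀ {x y} (x∈ : x ∈ xs) (y∈ : y ∈ xs) → R x y → S (f x∈) (f y∈)) →
                      Linked R xs → Linked S (mapWith∈ xs f)
    Linked-mapWith∈ f f-mono [] = []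
    Linked-mapWith∈ f f-mono [-] = [-]
    Linked-mapWith∈ f f-mono (rxy ∷ rys) =
      f-mono (here refl) (there (here refl)) rxy ∷
      Linked-mapWith∈ (f ∘ there) (λ x∈ y∈ → f-mono (there x∈) (there y∈)) rys

    AllPairs-mapWithAll : ∀ {P : Pred A p} {R : Rel A r} {S : Rel A s} →
                          (∀ {x y} → P x → P y → R x y → S x y) →
                          ∀ {xs} → All P xs → AllPairs R xs → AllPairs S xs
    AllPairs-mapWithAll R⇒S [] [] = []
    AllPairs-mapWithAll R⇒S (px ∷ pxs) (rx ∷ rxs) =
      All.zipWith (λ (py , rxy) → R⇒S px py rxy) (pxs , rx) ∷ AllPairs-mapWithAll R⇒S pxs rxs

    AllPairs-++⁻ : ∀ {R : Rel A r} xs {ys} → AllPairs R (xs ++ ys) →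
                   AllPairs R xs × All (λ x → All (R x) ys) xs × AllPairs R ys
    AllPairs-++⁻ [] rys = [] , [] , rys
    AllPairs-++⁻ (x ∷ xs) (rx ∷ rxs) =
      let rxs′ , across , rys = AllPairs-++⁻ xs rxs
          rx′ , rxy = All.++⁻ xs rx
      in rx′ ∷ rxs′ , rxy ∷ across , rys

    AllPairs-lookup : ∀ {R : Rel A r} {xs} → AllPairs R xs → ∀ {i j} → i Fin.< j →
                      R (lookup xs i) (lookup xs j)
    AllPairs-lookup {xs = x ∷ xs} (rx ∷ _)   {Fin.zero}  {Fin.suc j} _         = All.lookup rx (∈-lookup j)
    AllPairs-lookup {xs = x ∷ xs} (_ ∷ rxs) {Fin.suc i} {Fin.suc j} (s≤s i<j) = AllPairs-lookup rxs i<j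

  Unique-range⇒length≤ : ∀ {xs} lo N → Unique xs → (∀ {v} → v ∈ xs → lo ≤ v × v < lo + N) →
                         length xs ≤ N
  Unique-range⇒length≤ {xs} lo N xs! range = begin
    length xs                    ≤⟨ Unique-⊆⇒length≤ _≟_ xs! xs⊆range ⟩
    length (applyUpTo (lo +_) N) ≡⟨ length-applyUpTo (lo +_) N ⟩
    N                            ∎
    where
    open ≤-Reasoning
    xs⊆range : xs ⊆ applyUpTo (lo +_) N
    xs⊆range {v} v∈ with lo≤v , v<lo+N ← range v∈ =
      subst (_∈ applyUpTo (lo +_) N) (m+[n∸m]≡n lo≤v)
        (∈-applyUpTo⁺ (lo +_) (subst (v ∸ lo <_) (m+n∸m≡n lo N) (∸-monoˡ-< v<lo+N lo≤v)))

  module Rank {ℓ₁ ℓ₂} (O : StrictTotalOrder a ℓ₁ ℓ₂) (xs : List (StrictTotalOrder.Carrier O)) where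

    open StrictTotalOrder O
      using (Carrier; _≈_; compare; irrefl; <-respʳ-≈; module Eq)
      renaming (_<_ to _⊏_; _<?_ to _⊏?_; trans to ⊏-trans)

    rank : Carrier → ℕ
    rank y = length (filter (_⊏? y) xs)

    rank<length : ∀ {x} → x ∈ xs → rank x < length xs
    rank<length x∈ = filter-notAll (_⊏? _) xs (Any.map (λ { refl → irrefl Eq.refl }) x∈)

    rank-mono : ∀ {x y} → x ∈ xs → x ⊏ y → rank x < rank y
    rank-mono x∈ x⊏y =
      length-filter-strictMono (_⊏? _) (_⊏? _) (λ z⊏x → ⊏-trans z⊏x x⊏y) x∈ x⊏y (irrefl Eq.refl)

    rank-cancel-< : ∀ {x y} → y ∈ xs → rank x < rank y → x ⊏ y
    rank-cancel-< {x} {y} y∈ rx<ry with compare x y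
    ... | tri< x⊏y _ _ = x⊏y
    ... | tri≈ _ x≈y _ =
      contradiction rx<ry (≤⇒≯ (length-filter-mono (_⊏? y) (_⊏? x) (<-respʳ-≈ (Eq.sym x≈y)) xs))
    ... | tri> _ _ y⊏x = contradiction rx<ry (<⇒≯ (rank-mono y∈ y⊏x))

    rank-injective : ∀ {x y} → x ∈ xs → y ∈ xs → rank x ≡ rank y → x ≈ y
    rank-injective {x} {y} x∈ y∈ rx≡ry with compare x y
    ... | tri< x⊏y _ _ = contradiction rx≡ry (<⇒≢ (rank-mono x∈ x⊏y))
    ... | tri≈ _ x≈y _ = x≈y
    ... | tri> _ _ y⊏x = contradiction rx≡ry (≢-sym (<⇒≢ (rank-mono y∈ y⊏x)))

module Grid where

  open ListLemmas
  open import Data.Nat.Base using (zero; suc; _+_; _*_; _∸_; _≤_; _<_; z≤n; s≤s; s≤s⁻¹)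
  open import Data.Nat.Properties
  open import Data.Nat.Tactic.RingSolver using (solve-∀)
  open import Data.List.Base using (List; []; _∷_; length; filter; map)
  open import Data.List.Properties using (length-map)
  open import Data.List.Membership.Propositional using (_∈_; find; lose)
  open import Data.List.Membership.Propositional.Properties using (∈-filter⁻; ∈-map⁻)
  open import Data.List.Relation.Unary.Any using (Any; here; there; any?)
  open import Data.List.Relation.Unary.Linked using (Linked; [-]; _∷_)
  open import Data.List.Relation.Unary.Unique.Propositional using (Unique)
  import Data.List.Relation.Unary.Unique.Propositional.Properties as Unique
  open import Data.List.Relation.Binary.Subset.Propositional using (_⊆_)
  open import Data.Product using (_×_; _,_; proj₁; proj₂)
  open import Data.Empty using (⊥; ⊥-elim)
  open import Function using (_∘_)
  open import Relation.Nullary using (¬_; Dec; ¬?; contradiction)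
  open import Relation.Nullary.Decidable using (_×-dec_)
  open import Relation.Binary using (tri<; tri≈; tri>)
  open import Relation.Binary.PropositionalEquality
    using (_≡_; refl; sym; trans; cong; subst; ≢-sym; module ≡-Reasoning)

  Cell : Set
  Cell = ℕ × ℕ

  _≺_ : Cell → Cell → Set
  (x , y) ≺ (x′ , y′) = x < x′ × y < y′

  _≺?_ : ∀ s s′ → Dec (s ≺ s′)
  (x , y) ≺? (x′ , y′) = (x <? x′) ×-dec (y <? y′)

  InBox : ℕ → ℕ → ℕ → ℕ → Cell → Set
  InBox x₀ X y₀ Y (x , y) = (x₀ ≤ x × x < x₀ + X) × (y₀ ≤ y × y < y₀ + Y)

  ChainFree : ℕ → List Cell → Set
  ChainFree q S = ∀ ch → length ch ≡ q → ch ⊆ S → Linked _≺_ ch → ⊥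

  module _ {x₀ X y₀ Y : ℕ} {S : List Cell} (S! : Unique S)
           (box : ∀ {s} → s ∈ S → InBox x₀ (suc X) y₀ (suc Y) s)
           (antichain : ∀ {s s′} → s ∈ S → s′ ∈ S → ¬ s ≺ s′) where

    private
      top = y₀ + suc Y

      -- Numbering the antidiagonals: the key grows when a cell moves right without moving up,
      -- or down without moving left, and two cells of an antichain are always so placed.
      key : Cell → ℕ
      key (x , y) = x + (top ∸ y)

      key-<ˡ : ∀ {x y x′ y′} → x < x′ → y′ ≤ y → key (x , y) < key (x′ , y′)
      key-<ˡ x<x′ y′≤y = +-mono-<-≤ x<x′ (∸-monoʳ-≤ top y′≤y)

      key-<ʳ : ∀ {x y x′ y′} → x ≤ x′ → y′ < y → y ≤ top → key (x , y) < key (x′ , y′)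
      key-<ʳ x≤x′ y′<y y≤top = +-mono-≤-< x≤x′ (∸-monoʳ-< y′<y y≤top)

      y≤top : ∀ {s} → s ∈ S → proj₂ s ≤ top
      y≤top s∈ = <⇒≤ (proj₂ (proj₂ (box s∈)))

      key-injective : ∀ {s s′} → s ∈ S → s′ ∈ S → key s ≡ key s′ → s ≡ s′
      key-injective {x , y} {x′ , y′} s∈ s′∈ eq with <-cmp x x′ | <-cmp y y′
      ... | tri< x< _ _   | tri< y< _ _   = contradiction (x< , y<) (antichain s∈ s′∈)
      ... | tri< x< _ _   | tri≈ _ y≡ _   = contradiction eq (<⇒≢ (key-<ˡ x< (≤-reflexive (sym y≡))))
      ... | tri< x< _ _   | tri> _ _ y>   = contradiction eq (<⇒≢ (key-<ˡ x< (<⇒≤ y>)))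
      ... | tri≈ _ x≡ _   | tri< y< _ _   =
        contradiction eq (≢-sym (<⇒≢ (key-<ʳ (≤-reflexive (sym x≡)) y< (y≤top s′∈))))
      ... | tri≈ _ refl _ | tri≈ _ refl _ = refl
      ... | tri≈ _ x≡ _   | tri> _ _ y>   = contradiction eq (<⇒≢ (key-<ʳ (≤-reflexive x≡) y> (y≤top s∈)))
      ... | tri> _ _ x>   | tri< y< _ _   = contradiction eq (≢-sym (<⇒≢ (key-<ˡ x> (<⇒≤ y<))))
      ... | tri> _ _ x>   | tri≈ _ y≡ _   = contradiction eq (≢-sym (<⇒≢ (key-<ˡ x> (≤-reflexive y≡))))
      ... | tri> _ _ x>   | tri> _ _ y>   = contradiction (x> , y>) (antichain s′∈ s∈)

      key-range : ∀ {v} → v ∈ map key S → suc x₀ ≤ v × v < suc x₀ + suc (X + Y)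
      key-range v∈ with (x , y) , s∈ , refl ← ∈-map⁻ key v∈
                   with (x₀≤x , x<) , (y₀≤y , y<) ← box s∈ =
        subst (_≤ key (x , y)) (+-comm x₀ 1) (+-mono-≤ x₀≤x (m<n⇒0<n∸m y<)) ,
        s≤s (begin
          x + (top ∸ y)        ≤⟨ +-mono-≤ (s≤s⁻¹ (subst (x <_) (+-suc x₀ X) x<))
                                           (∸-monoʳ-≤ top y₀≤y) ⟩
          x₀ + X + (top ∸ y₀)  ≡⟨ cong (x₀ + X +_) (m+n∸m≡n y₀ (suc Y)) ⟩
          x₀ + X + suc Y       ≡⟨ +-assoc x₀ X (suc Y) ⟩
          x₀ + (X + suc Y)     ≡⟨ cong (x₀ +_) (+-suc X Y) ⟩
          x₀ + suc (X + Y)     ∎)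
        where open ≤-Reasoning

    antichain-length≤ : length S ≤ suc (X + Y)
    antichain-length≤ = subst (_≤ suc (X + Y)) (length-map key S)
      (Unique-range⇒length≤ (suc x₀) (suc (X + Y)) (Unique-map⁺ key S! key-injective) key-range)

  private
    peel-identity : ∀ w X Y → w ≤ X + Y →
                    suc (X + Y) + w * (X + Y ∸ w) ≡ suc w * (suc X + suc Y ∸ suc w)
    peel-identity w X Y w≤X+Y = begin
      suc (X + Y) + w * D      ≡⟨ cong (λ z → suc z + w * D) (sym (m∸n+n≡m w≤X+Y)) ⟩
      suc (D + w) + w * D      ≡⟨ semiring D w ⟩
      suc w * suc D            ≡⟨ cong (suc w *_) suc-D ⟨
      suc w * (X + suc Y ∸ w)  ∎
      where
      open ≡-Reasoning
      D = X + Y ∸ w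
      suc-D : X + suc Y ∸ w ≡ suc D
      suc-D = trans (cong (_∸ w) (+-suc X Y)) (+-∸-assoc 1 w≤X+Y)
      semiring : ∀ D w → suc (D + w) + w * D ≡ suc w * suc D
      semiring = solve-∀

  -- Induction on w: the cells having a ≺-predecessor in S contain no chain of length w and
  -- lie in a smaller box, while the others form an antichain.
  chainFree-length≤ : ∀ w {x₀ X y₀ Y} S → Unique S → (∀ {s} → s ∈ S → InBox x₀ X y₀ Y s) →
                      ChainFree (suc w) S → w ≤ X → w ≤ Y → length S ≤ w * (X + Y ∸ w)
  chainFree-length≤ zero [] _ _ _ _ _ = z≤n
  chainFree-length≤ zero (s ∷ _) _ _ chainFree _ _ =
    ⊥-elim (chainFree (s ∷ []) refl (λ { (here refl) → here refl }) [-])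
  chainFree-length≤ (suc w) {x₀} {suc X} {y₀} {suc Y} S S! box chainFree (s≤s w≤X) (s≤s w≤Y) = begin
    length S                          ≡⟨ length-filter-+-∁ hasPred? S ⟨
    length N + length M               ≤⟨ +-mono-≤ N-bound M-bound ⟩
    w * (X + Y ∸ w) + suc (X + Y)     ≡⟨ +-comm _ (suc (X + Y)) ⟩
    suc (X + Y) + w * (X + Y ∸ w)     ≡⟨ peel-identity w X Y (≤-trans w≤X (m≤m+n X Y)) ⟩
    suc w * (suc X + suc Y ∸ suc w)   ∎
    where
    open ≤-Reasoning
    HasPred : Cell → Set
    HasPred s = Any (_≺ s) S
    hasPred? : ∀ s → Dec (HasPred s)
    hasPred? s = any? (_≺? s) S
    N = filter hasPred? S
    M = filter (¬? ∘ hasPred?) S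
    ∈N⁻ : ∀ {s} → s ∈ N → s ∈ S × HasPred s
    ∈N⁻ = ∈-filter⁻ hasPred? {xs = S}
    ∈M⁻ : ∀ {s} → s ∈ M → s ∈ S × ¬ HasPred s
    ∈M⁻ = ∈-filter⁻ (¬? ∘ hasPred?) {xs = S}

    N-box : ∀ {s} → s ∈ N → InBox (suc x₀) X (suc y₀) Y s
    N-box {x , y} s∈N with s∈S , pred ← ∈N⁻ s∈N
                      with (x′ , y′) , s′∈S , (x′<x , y′<y) ← find pred
      with (x₀≤x′ , _) , (y₀≤y′ , _) ← box s′∈S with (_ , x<) , (_ , y<) ← box s∈S =
      (≤-<-trans x₀≤x′ x′<x , subst (x <_) (+-suc x₀ X) x<) ,
      (≤-<-trans y₀≤y′ y′<y , subst (y <_) (+-suc y₀ Y) y<)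

    N-chainFree : ChainFree (suc w) N
    N-chainFree (h ∷ ch) len ch⊆N chain with _ , pred ← ∈N⁻ (ch⊆N (here refl))
      with s′ , s′∈S , s′≺h ← find pred =
      chainFree (s′ ∷ h ∷ ch) (cong suc len)
        (λ { (here refl) → s′∈S ; (there c∈) → proj₁ (∈N⁻ (ch⊆N c∈)) })
        (s′≺h ∷ chain)

    N-bound : length N ≤ w * (X + Y ∸ w)
    N-bound = chainFree-length≤ w N (Unique.filter⁺ hasPred? S!) N-box N-chainFree w≤X w≤Y

    M-bound : length M ≤ suc (X + Y)
    M-bound = antichain-length≤ (Unique.filter⁺ (¬? ∘ hasPred?) S!) (box ∘ proj₁ ∘ ∈M⁻)
      (λ s∈M s′∈M s≺s′ → proj₂ (∈M⁻ s′∈M) (lose (proj₁ (∈M⁻ s∈M)) s≺s′))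

module Intervals where

  open ListLemmas
  open import Data.Nat.Base as ℕ using ()
  open import Data.Fin.Base as Fin using ()
  open import Data.Rational.Base using (_<_; _≤_)
  import Data.Rational.Properties as ℚ
  open import Data.List.Base using (List; _∷_; length; lookup; tabulate)
  open import Data.List.Properties using (length-tabulate)
  open import Data.List.Membership.Propositional using (_∈_)
  open import Data.List.Membership.Propositional.Properties using (∈-lookup)
  open import Data.List.Relation.Unary.All as All using (All)
  import Data.List.Relation.Unary.All.Properties as All
  open import Data.List.Relation.Unary.AllPairs using (AllPairs)
  import Data.List.Relation.Unary.AllPairs.Properties as AllPairs
  open import Data.Maybe.Base using (just)
  open import Data.Product using (∃; _×_; _,_; proj₁; proj₂)
  open import Data.Sum.Base as Sum using (_⊎_; inj₁; inj₂)
  open import Data.Empty using (⊥; ⊥-elim)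
  open import Function using (_∘_)
  open import Relation.Nullary using (yes; no)
  open import Relation.Binary.PropositionalEquality using (_≡_; _≢_; sym; subst)

  HasEndpointIn : Interval → Interval → Set
  HasEndpointIn J I = lo I ∈ᴵ J ⊎ hi I ∈ᴵ J

  HasEndpointIn-mono : ∀ {I J J′} → J ⊆ᴵ J′ → HasEndpointIn J I → HasEndpointIn J′ I
  HasEndpointIn-mono J⊆J′ = Sum.map (J⊆J′ _) (J⊆J′ _)

  Overlap-intro : ∀ {I J} → lo I < lo J → lo J < hi I → hi I < hi J → Overlap I J
  Overlap-intro {I} {J} lI<lJ lJ<hI hI<hJ =
    let x , lJ<x , x<hI = ℚ.<-dense lJ<hI
        y , lI<y , y<lJ = ℚ.<-dense lI<lJ
        z , hI<z , z<hJ = ℚ.<-dense hI<hJ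
    in (x , (ℚ.<-trans lI<lJ lJ<x , x<hI) , (lJ<x , ℚ.<-trans x<hI hI<hJ)) ,
       (λ I⊆J → ℚ.<-asym y<lJ (proj₁ (I⊆J y (lI<y , ℚ.<-trans y<lJ lJ<hI)))) ,
       (λ J⊆I → ℚ.<-asym hI<z (proj₂ (J⊆I z (ℚ.<-trans lJ<hI hI<z , z<hJ))))

  Overlap-sym : ∀ {I J} → Overlap I J → Overlap J I
  Overlap-sym ((x , x∈I , x∈J) , I⊈J , J⊈I) = (x , x∈J , x∈I) , J⊈I , I⊈J

  Disjointᴵ : Interval → Interval → Set
  Disjointᴵ I J = ∀ x → x ∈ᴵ I → x ∈ᴵ J → ⊥

  Disjointᴵ-ordered : ∀ {I J x y} → Disjointᴵ I J → lo I < lo J → x ∈ᴵ I → y ∈ᴵ J → x < y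
  Disjointᴵ-ordered {I} {J} {x} {y} I∩J=∅ lI<lJ (lI<x , x<hI) (lJ<y , y<hJ) with x ℚ.<? y
  ... | yes x<y = x<y
  ... | no x≮y = ⊥-elim (I∩J=∅ y (ℚ.<-trans lI<lJ lJ<y , ℚ.≤-<-trans (ℚ.≮⇒≥ x≮y) x<hI)
                                  (lJ<y , y<hJ))

  Disjointᴵ⇒lo≢ : ∀ {I J} → Disjointᴵ I J → lo I ≢ lo J
  Disjointᴵ⇒lo≢ {I} {J} I∩J=∅ lI≡lJ with ℚ.≤-total (hi I) (hi J)
  ... | inj₁ hI≤hJ = let x , lI<x , x<hI = ℚ.<-dense (lo<hi I)
                     in I∩J=∅ x (lI<x , x<hI) (subst (_< x) lI≡lJ lI<x , ℚ.<-≤-trans x<hI hI≤hJ)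
  ... | inj₂ hJ≤hI = let x , lJ<x , x<hJ = ℚ.<-dense (lo<hi J)
                     in I∩J=∅ x (subst (_< x) (sym lI≡lJ) lJ<x , ℚ.<-≤-trans x<hJ hJ≤hI) (lJ<x , x<hJ)

  module _ {n : ℕ} (𝓘 : Fin n → Interval) {e : Interval → ℚ} {X : Fin n → Set} {ψ : Fin n → Maybe ℕ}
           (structured : StructuredAt 𝓘 e X ψ) where

    structured-clique : ∀ {A : Set} (f : A → Fin n) (col : A → ℕ) (x : A) (xs : List A) →
      All (λ y → X (f y) × ψ (f y) ≡ just (col y)) (x ∷ xs) →
      AllPairs (λ y z → col y ℕ.< col z × e (𝓘 (f y)) < e (𝓘 (f z))) (x ∷ xs) →
      ∃ λ is → length is ≡ length (x ∷ xs) × AllPairs (λ i j → Overlap (𝓘 i) (𝓘 j)) is ×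
               All (λ i → X i × e (𝓘 (f x)) ≤ e (𝓘 i) ×
                          ∃ λ y → y ∈ x ∷ xs × e (𝓘 i) ≤ e (𝓘 (f y))) is
    structured-clique f col x xs valid increasing =
      let J , J-valid , J-overlapping , J-between =
            structured (length xs) (f ∘ item) (col ∘ item)
              (λ j → proj₁ (All.lookup valid (∈-lookup j))) (λ j → proj₂ (All.lookup valid (∈-lookup j)))
              (λ _ _ j<j′ → AllPairs-lookup increasing j<j′)
      in tabulate J , length-tabulate J , AllPairs.tabulate⁺ (λ {j} {j′} → J-overlapping j j′) ,
         All.tabulate⁺ λ j → J-valid j , proj₁ (J-between j) , item last , ∈-lookup last , proj₂ (J-between j)
      where
      item = lookup (x ∷ xs)
      last = Fin.fromℕ (length xs)

module Arch {n m : ℕ} (𝓘 : Fin n → Interval) (P : Fin m → ℚ) (pillars : IsPillarSet 𝓘 P)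
            (ψ : Fin n → Maybe ℕ) (assignment : IsPillarAssignment 𝓘 P ψ)
            (K : Interval) (arch : IsArch 𝓘 P (lo K) (hi K)) where

  open ListLemmas
  open Grid
  open Intervals
  open import Data.Bool.Base using (Bool; true; false)
  import Data.Bool.Properties as Bool
  open import Data.Nat.Base as ℕ using ()
  import Data.Nat.Properties as ℕ
  open import Data.Fin.Base as Fin using ()
  import Data.Fin.Properties as Fin
  open import Data.Rational.Base using (0ℚ; 1ℚ; _<_; _≤_)
  import Data.Rational.Properties as ℚ
  open import Data.List.Base using (List; []; _∷_; _++_; length; map; concat; filter; allFin)
  open import Data.List.Properties
    using (length-tabulate; length-++; length-map; ++-identityʳ; ++-assoc; map-∘; map-cong)
  import Data.List.Extrema
  open import Data.List.Membership.Propositional using (_∈_; mapWith∈)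
  open import Data.List.Membership.Propositional.Properties
    using (∈-map⁺; ∈-map⁻; ∈-concat⁻′; ∈-map∘filter⁺; ∈-map∘filter⁻; ∈-allFin)
  open import Data.List.Membership.Setoid.Properties using (length-mapWith∈)
  import Data.List.Relation.Unary.Any.Properties as Any
  open import Data.List.Relation.Unary.All as All using (All; []; _∷_)
  import Data.List.Relation.Unary.All.Properties as All
  open import Data.List.Relation.Unary.AllPairs as AllPairs using (AllPairs; []; _∷_)
  import Data.List.Relation.Unary.AllPairs.Properties as AllPairs
  open import Data.List.Relation.Unary.Linked.Properties using (Linked⇒AllPairs)
  open import Data.List.Relation.Unary.Unique.Propositional using (Unique)
  import Data.List.Relation.Unary.Unique.Propositional.Properties as Unique
  open import Data.List.Relation.Binary.Disjoint.Propositional using (Disjoint)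
  open import Data.Maybe.Base using (just)
  import Data.Maybe.Properties as Maybe
  open import Data.Nat.ListAction using (sum)
  open import Data.Product using (∃; _×_; _,_; proj₁; proj₂)
  open import Data.Product.Relation.Binary.Lex.Strict using (×-strictTotalOrder)
  open import Data.Sum.Base using (_⊎_; inj₁; inj₂; [_,_]′)
  open import Data.Unit using (⊤)
  open import Function using (id; _∘_)
  open import Relation.Unary using (Decidable)
  open import Relation.Nullary using (¬_; yes; no; contradiction)
  open import Relation.Nullary.Decidable using (_×-dec_)
  open import Relation.Binary using (StrictTotalOrder; DecTotalOrder; tri<; tri≈; tri>)
  open import Relation.Binary.PropositionalEquality
    using (_≡_; _≢_; refl; sym; trans; cong; cong₂; subst; subst₂; setoid; module ≡-Reasoning)

  Asg : Fin m → Fin n → Set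
  Asg = Assigned 𝓘 P

  InK : Fin n → Set
  InK i = HasEndpointIn K (𝓘 i)

  private
    P-injective : ∀ {k k′} → P k ≡ P k′ → k ≡ k′
    P-injective = proj₁ pillars _ _

    0<P : ∀ k → 0ℚ < P k
    0<P k = proj₁ (proj₂ pillars k)

    P<1 : ∀ k → P k < 1ℚ
    P<1 k = proj₁ (proj₂ (proj₂ pillars k))

    P∉K : ∀ k → ¬ P k ∈ᴵ K
    P∉K = proj₂ (proj₂ (proj₂ arch))

    0≤lo-K : 0ℚ ≤ lo K
    0≤lo-K with proj₁ (proj₂ arch)
    ... | inj₁ lo≡0              = ℚ.≤-reflexive (sym lo≡0)
    ... | inj₂ (inj₁ lo≡1)       = subst (0ℚ ≤_) (sym lo≡1) (ℚ.nonNegative⁻¹ 1ℚ)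
    ... | inj₂ (inj₂ (k , P≡lo)) = subst (0ℚ ≤_) P≡lo (ℚ.<⇒≤ (0<P k))

    hi-K≤1 : hi K ≤ 1ℚ
    hi-K≤1 with proj₁ (proj₂ (proj₂ arch))
    ... | inj₁ hi≡0              = subst (_≤ 1ℚ) (sym hi≡0) (ℚ.nonNegative⁻¹ 1ℚ)
    ... | inj₂ (inj₁ hi≡1)       = ℚ.≤-reflexive hi≡1
    ... | inj₂ (inj₂ (k , P≡hi)) = subst (_≤ 1ℚ) P≡hi (ℚ.<⇒≤ (P<1 k))

    right-of-K : ∀ k → ¬ P k ≤ lo K → hi K ≤ P k
    right-of-K k P≰lo = ℚ.≮⇒≥ (λ P<hi → P∉K k (ℚ.≰⇒> P≰lo , P<hi))

    left-of-K : ∀ k → ¬ hi K ≤ P k → P k ≤ lo K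
    left-of-K k hi≰P = ℚ.≮⇒≥ (λ lo<P → P∉K k (lo<P , ℚ.≰⇒> hi≰P))

    lo∉K : ∀ {k i} → Asg k i → P k ≤ lo K → ¬ lo (𝓘 i) ∈ᴵ K
    lo∉K ((lo<P , _) , _) P≤a (a<lo , _) = ℚ.<-asym lo<P (ℚ.≤-<-trans P≤a a<lo)

    hi∉K : ∀ {k i} → Asg k i → hi K ≤ P k → ¬ hi (𝓘 i) ∈ᴵ K
    hi∉K ((_ , P<hi) , _) b≤P (_ , hi<b) = ℚ.<-asym P<hi (ℚ.<-≤-trans hi<b b≤P)

    hi∈K : ∀ {k i} → Asg k i → P k ≤ lo K → InK i → hi (𝓘 i) ∈ᴵ K
    hi∈K asg P≤a (inj₁ lo∈K) = contradiction lo∈K (lo∉K asg P≤a)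
    hi∈K asg P≤a (inj₂ hi∈K) = hi∈K

    lo∈K : ∀ {k i} → Asg k i → hi K ≤ P k → InK i → lo (𝓘 i) ∈ᴵ K
    lo∈K asg b≤P (inj₁ lo∈K) = lo∈K
    lo∈K asg b≤P (inj₂ hi∈K) = contradiction hi∈K (hi∉K asg b≤P)

  -- The only endpoint through which an interval assigned to k can meet K.
  endpoint : Fin m → Interval → ℚ
  endpoint k with P k ℚ.≤? lo K
  ... | yes _ = hi
  ... | no _  = lo

  endpoint-∈ : ∀ {k i J} → Asg k i → J ⊆ᴵ K → HasEndpointIn J (𝓘 i) → endpoint k (𝓘 i) ∈ᴵ J
  endpoint-∈ {k} asg J⊆K i∩J with P k ℚ.≤? lo K | i∩J
  ... | yes P≤a | inj₁ lo∈J = contradiction (J⊆K _ lo∈J) (lo∉K asg P≤a)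
  ... | yes _   | inj₂ hi∈J = hi∈J
  ... | no _    | inj₁ lo∈J = lo∈J
  ... | no P≰a  | inj₂ hi∈J = contradiction (J⊆K _ hi∈J) (hi∉K asg (right-of-K k P≰a))

  endpoint-∈K : ∀ {k i} → Asg k i → InK i → endpoint k (𝓘 i) ∈ᴵ K
  endpoint-∈K asg = endpoint-∈ {J = K} asg (λ _ x∈K → x∈K)

  endpoint-∈K⇒InK : ∀ k i → endpoint k (𝓘 i) ∈ᴵ K → InK i
  endpoint-∈K⇒InK k i with P k ℚ.≤? lo K
  ... | yes _ = inj₂
  ... | no _  = inj₁

  structured-endpoint : ∀ k → StructuredAt 𝓘 (endpoint k) (Asg k) ψ
  structured-endpoint k with proj₂ assignment k | P k ℚ.≤? lo K
  ... | _ , _ , _ , _ , (_ , _ , _ , structured-hi) | yes _ = structured-hi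
  ... | _ , _ , _ , _ , (_ , _ , structured-lo , _) | no _  = structured-lo

  crossing⇒≡ : ∀ {k k′ i i′} → Asg k i → Asg k′ i′ → P k ∈ᴵ 𝓘 i′ → P k′ ∈ᴵ 𝓘 i → k ≡ k′
  crossing⇒≡ {k} {k′} (_ , first) (_ , first′) P∈i′ P′∈i with Fin.<-cmp k k′
  ... | tri< k<k′ _ _ = contradiction P∈i′ (first′ k k<k′)
  ... | tri≈ _ k≡k′ _ = k≡k′
  ... | tri> _ _ k′<k = contradiction P′∈i (first k′ k′<k)

  pillarOrder : StrictTotalOrder _ _ _
  pillarOrder = ×-strictTotalOrder Bool.<-strictTotalOrder ℚ.<-strictTotalOrder

  open StrictTotalOrder pillarOrder public using () renaming (_<_ to _⊏_)

  isLeft : Fin m → Bool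
  isLeft k with P k ℚ.≤? lo K
  ... | yes _ = true
  ... | no _  = false

  -- Ordered by pillarKey, the pillars right of K come first (false < true), then those left
  -- of K; on each side from left to right.
  pillarKey : Fin m → Bool × ℚ
  pillarKey k = isLeft k , P k

  -- On one side of K, were the intervals not interleaved, each would contain the other's pillar.
  ordered⇒Overlap : ∀ {k k′ i i′} → Asg k i → InK i → Asg k′ i′ → InK i′ →
                    pillarKey k ⊏ pillarKey k′ → endpoint k (𝓘 i) < endpoint k′ (𝓘 i′) →
                    Overlap (𝓘 i) (𝓘 i′)
  ordered⇒Overlap {k} {k′} {i} {i′} asg i∩K asg′ i′∩K k⊏k′ e<e′
    with P k ℚ.≤? lo K | P k′ ℚ.≤? lo K | k⊏k′
  ... | yes P≤a | yes P′≤a | inj₂ (_ , P<P′) = Overlap-intro {𝓘 i} {𝓘 i′} lo<lo′ lo′<hi e<e′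
    where
    lo′<hi : lo (𝓘 i′) < hi (𝓘 i)
    lo′<hi = ℚ.<-trans (proj₁ (proj₁ asg′)) (ℚ.≤-<-trans P′≤a (proj₁ (hi∈K asg P≤a i∩K)))
    lo<lo′ : lo (𝓘 i) < lo (𝓘 i′)
    lo<lo′ with P k ℚ.≤? lo (𝓘 i′)
    ... | yes P≤lo′ = ℚ.<-≤-trans (proj₁ (proj₁ asg)) P≤lo′
    ... | no P≰lo′ = contradiction (cong P (crossing⇒≡ asg asg′ P∈i′ P′∈i)) (ℚ.<⇒≢ P<P′)
      where
      P∈i′ : P k ∈ᴵ 𝓘 i′
      P∈i′ = ℚ.≰⇒> P≰lo′ , ℚ.<-trans P<P′ (proj₂ (proj₁ asg′))
      P′∈i : P k′ ∈ᴵ 𝓘 i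
      P′∈i = ℚ.<-trans (proj₁ (proj₁ asg)) P<P′ , ℚ.≤-<-trans P′≤a (proj₁ (hi∈K asg P≤a i∩K))
  ... | no P≰a | no P′≰a | inj₂ (_ , P<P′) = Overlap-intro {𝓘 i} {𝓘 i′} e<e′ lo′<hi hi<hi′
    where
    b≤P : hi K ≤ P k
    b≤P = right-of-K k P≰a
    lo′<b : lo (𝓘 i′) < hi K
    lo′<b = proj₂ (lo∈K asg′ (right-of-K k′ P′≰a) i′∩K)
    lo′<hi : lo (𝓘 i′) < hi (𝓘 i)
    lo′<hi = ℚ.<-trans (ℚ.<-≤-trans lo′<b b≤P) (proj₂ (proj₁ asg))
    hi<hi′ : hi (𝓘 i) < hi (𝓘 i′)
    hi<hi′ with hi (𝓘 i) ℚ.≤? P k′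
    ... | yes hi≤P′ = ℚ.≤-<-trans hi≤P′ (proj₂ (proj₁ asg′))
    ... | no hi≰P′ = contradiction (cong P (crossing⇒≡ asg asg′ P∈i′ P′∈i)) (ℚ.<⇒≢ P<P′)
      where
      P∈i′ : P k ∈ᴵ 𝓘 i′
      P∈i′ = ℚ.<-≤-trans lo′<b b≤P , ℚ.<-trans P<P′ (proj₂ (proj₁ asg′))
      P′∈i : P k′ ∈ᴵ 𝓘 i
      P′∈i = ℚ.<-trans (proj₁ (proj₁ asg)) P<P′ , ℚ.≰⇒> hi≰P′
  ... | no P≰a | yes P′≤a | _ =
    Overlap-sym {𝓘 i′} {𝓘 i} (Overlap-intro {𝓘 i′} {𝓘 i} lo′<lo e<e′ hi′<hi)
    where
    lo′<lo : lo (𝓘 i′) < lo (𝓘 i)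
    lo′<lo = ℚ.<-trans (proj₁ (proj₁ asg′))
                       (ℚ.≤-<-trans P′≤a (proj₁ (lo∈K asg (right-of-K k P≰a) i∩K)))
    hi′<hi : hi (𝓘 i′) < hi (𝓘 i)
    hi′<hi = ℚ.<-trans (ℚ.<-≤-trans (proj₂ (hi∈K asg′ P′≤a i′∩K)) (right-of-K k P≰a))
                       (proj₂ (proj₁ asg))
  ... | yes _ | no _  | inj₁ ()
  ... | yes _ | no _  | inj₂ (() , _)
  ... | yes _ | yes _ | inj₁ ()
  ... | no _  | no _  | inj₁ ()

  private
    module Extrema = Data.List.Extrema (DecTotalOrder.totalOrder ℚ.≤-decTotalOrder)

    earlier : Fin m → {Q : ℚ → Set} → Decidable Q → List ℚ
    earlier k Q? = map P (filter (λ k′ → (k′ Fin.<? k) ×-dec Q? (P k′)) (allFin m))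

    ∈earlier⁺ : ∀ {k k′} {Q : ℚ → Set} (Q? : Decidable Q) → k′ Fin.< k → Q (P k′) →
                P k′ ∈ earlier k Q?
    ∈earlier⁺ Q? k′<k Q[P′] = ∈-map∘filter⁺ P _ (_ , ∈-allFin _ , refl , k′<k , Q[P′])

    ∈earlier⁻ : ∀ {k x} {Q : ℚ → Set} (Q? : Decidable Q) → x ∈ earlier k Q? →
                ∃ λ k′ → (k′ Fin.< k × Q (P k′)) × x ≡ P k′
    ∈earlier⁻ Q? x∈ with k′ , _ , x≡P′ , k′-earlier ← ∈-map∘filter⁻ P _ {xs = allFin m} x∈ =
      k′ , k′-earlier , x≡P′

  foundationLo foundationHi : Fin m → ℚ
  foundationLo k = Extrema.max 0ℚ (earlier k (ℚ._<? P k))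
  foundationHi k = Extrema.min 1ℚ (earlier k (P k ℚ.<?_))

  isFoundation : ∀ k → IsFoundation 𝓘 P k (foundationLo k) (foundationHi k)
  isFoundation k = proj₁ lo-bound , proj₁ hi-bound , (proj₂ lo-bound , proj₂ hi-bound) , no-earlier
    where
    lo-bound : EarlierOr01 𝓘 P k (foundationLo k) × foundationLo k < P k
    lo-bound = Extrema.argmax-all id {P = λ x → EarlierOr01 𝓘 P k x × x < P k} (inj₁ refl , 0<P k)
      (All.tabulate λ x∈ → let k′ , (k′<k , P′<P) , x≡P′ = ∈earlier⁻ (ℚ._<? P k) x∈
                           in inj₂ (inj₂ (k′ , k′<k , sym x≡P′)) , subst (_< P k) (sym x≡P′) P′<P)
    hi-bound : EarlierOr01 𝓘 P k (foundationHi k) × P k < foundationHi k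
    hi-bound = Extrema.argmin-all id {P = λ x → EarlierOr01 𝓘 P k x × P k < x} (inj₂ (inj₁ refl) , P<1 k)
      (All.tabulate λ x∈ → let k′ , (k′<k , P<P′) , x≡P′ = ∈earlier⁻ (P k ℚ.<?_) x∈
                           in inj₂ (inj₂ (k′ , k′<k , sym x≡P′)) , subst (P k <_) (sym x≡P′) P<P′)
    no-earlier : ∀ k′ → k′ Fin.< k → ¬ P k′ ∈⟨ foundationLo k , foundationHi k ⟩
    no-earlier k′ k′<k (lo<P′ , P′<hi) with ℚ.<-cmp (P k′) (P k)
    ... | tri< P′<P _ _ = ℚ.<-irrefl refl
          (ℚ.<-≤-trans lo<P′ (All.lookup (Extrema.xs≤max 0ℚ _) (∈earlier⁺ (ℚ._<? P k) k′<k P′<P)))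
    ... | tri≈ _ P′≡P _ = Fin.<-irrefl (P-injective P′≡P) k′<k
    ... | tri> _ _ P<P′ = ℚ.<-irrefl refl
          (ℚ.≤-<-trans (All.lookup (Extrema.min≤xs 1ℚ _) (∈earlier⁺ (P k ℚ.<?_) k′<k P<P′)) P′<hi)

  private
    earlier-below⇒left-of-K : ∀ {k i k′} → Asg k i → InK i → k′ Fin.< k → P k′ < P k → P k′ ≤ lo K
    earlier-below⇒left-of-K {k} {i} {k′} asg i∩K k′<k P′<P with P k′ ℚ.≤? lo K
    ... | yes P′≤a = P′≤a
    ... | no P′≰a = contradiction (lo<P′ , ℚ.<-trans P′<P (proj₂ (proj₁ asg))) (proj₂ asg k′ k′<k)
      where
      lo<P′ : lo (𝓘 i) < P k′
      lo<P′ = ℚ.<-≤-trans (proj₂ (lo∈K asg (ℚ.≤-trans (right-of-K k′ P′≰a) (ℚ.<⇒≤ P′<P)) i∩K))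
                          (right-of-K k′ P′≰a)

    earlier-above⇒right-of-K : ∀ {k i k′} → Asg k i → InK i → k′ Fin.< k → P k < P k′ → hi K ≤ P k′
    earlier-above⇒right-of-K {k} {i} {k′} asg i∩K k′<k P<P′ with hi K ℚ.≤? P k′
    ... | yes b≤P′ = b≤P′
    ... | no b≰P′ = contradiction (ℚ.<-trans (proj₁ (proj₁ asg)) P<P′ , P′<hi) (proj₂ asg k′ k′<k)
      where
      P′<hi : P k′ < hi (𝓘 i)
      P′<hi = ℚ.≤-<-trans (left-of-K k′ b≰P′)
                          (proj₁ (hi∈K asg (ℚ.≤-trans (ℚ.<⇒≤ P<P′) (left-of-K k′ b≰P′)) i∩K))

  K⊆foundation : ∀ {k i} → Asg k i → InK i →
                 ∀ x → x ∈ᴵ K → x ∈⟨ foundationLo k , foundationHi k ⟩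
  K⊆foundation {k} asg i∩K x (a<x , x<b) = ℚ.≤-<-trans lo≤a a<x , ℚ.<-≤-trans x<b b≤hi
    where
    lo≤a : foundationLo k ≤ lo K
    lo≤a = Extrema.max≤v⁺ 0≤lo-K (All.tabulate λ x∈ →
      let k′ , (k′<k , P′<P) , x≡P′ = ∈earlier⁻ (ℚ._<? P k) x∈
      in subst (_≤ lo K) (sym x≡P′) (earlier-below⇒left-of-K asg i∩K k′<k P′<P))
    b≤hi : hi K ≤ foundationHi k
    b≤hi = Extrema.v≤min⁺ hi-K≤1 (All.tabulate λ x∈ →
      let k′ , (k′<k , P<P′) , x≡P′ = ∈earlier⁻ (P k ℚ.<?_) x∈
      in subst (hi K ≤_) (sym x≡P′) (earlier-above⇒right-of-K asg i∩K k′<k P<P′))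

  earlier⇒InFoundationSet : ∀ {k₀ i₀ k i} → k₀ Fin.< k → Asg k₀ i₀ → InK i₀ → Asg k i → InK i →
                            InFoundationSet 𝓘 P k i₀
  earlier⇒InFoundationSet {k₀} {i₀} {k} k₀<k asg₀ i₀∩K asg i∩K =
    foundationLo k , foundationHi k , isFoundation k , one-endpoint-in-F i₀∩K
    where
    _∈F : ℚ → Set
    x ∈F = x ∈⟨ foundationLo k , foundationHi k ⟩
    ¬both : ¬ (lo (𝓘 i₀) ∈F × hi (𝓘 i₀) ∈F)
    ¬both ((F<lo₀ , _) , (_ , hi₀<F)) = proj₂ (proj₂ (proj₂ (isFoundation k))) k₀ k₀<k
      (ℚ.<-trans F<lo₀ (proj₁ (proj₁ asg₀)) , ℚ.<-trans (proj₂ (proj₁ asg₀)) hi₀<F)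
    one-endpoint-in-F : InK i₀ →
                        (lo (𝓘 i₀) ∈F × ¬ hi (𝓘 i₀) ∈F) ⊎ (¬ lo (𝓘 i₀) ∈F × hi (𝓘 i₀) ∈F)
    one-endpoint-in-F (inj₁ lo₀∈K) =
      let lo₀∈F = K⊆foundation asg i∩K _ lo₀∈K in inj₁ (lo₀∈F , ¬both ∘ (lo₀∈F ,_))
    one-endpoint-in-F (inj₂ hi₀∈K) =
      let hi₀∈F = K⊆foundation asg i∩K _ hi₀∈K in inj₂ (¬both ∘ (_, hi₀∈F) , hi₀∈F)

  private
    colour-fresh : ∀ {k i c} → Asg k i → ψ i ≡ just c → ¬ UsedBefore 𝓘 P ψ k c
    colour-fresh {k} {i} asg ψi≡c with proj₂ assignment k
    ... | _ , _ , C , (_ , _ , C-fresh , _) , (colours-in-C , _) with colours-in-C i asg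
    ...   | c′ , ψi≡c′ , c′∈C =
      proj₂ (All.lookup C-fresh (subst (_∈ C) (Maybe.just-injective (trans (sym ψi≡c′) ψi≡c)) c′∈C))

  colour-determines-pillar : ∀ {k₀ i₀ k i c} → Asg k₀ i₀ → InK i₀ → Asg k i → InK i →
                             ψ i₀ ≡ just c → ψ i ≡ just c → k₀ ≡ k
  colour-determines-pillar {k₀} {i₀} {k} {i} asg₀ i₀∩K asg i∩K ψi₀≡c ψi≡c with Fin.<-cmp k₀ k
  ... | tri< k₀<k _ _ = contradiction
          (i₀ , earlier⇒InFoundationSet k₀<k asg₀ i₀∩K asg i∩K , (k₀ , k₀<k , asg₀) , ψi₀≡c)
          (colour-fresh asg ψi≡c)
  ... | tri≈ _ k₀≡k _ = k₀≡k
  ... | tri> _ _ k<k₀ = contradiction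
          (i , earlier⇒InFoundationSet k<k₀ asg i∩K asg₀ i₀∩K , (k , k<k₀ , asg) , ψi≡c)
          (colour-fresh asg₀ ψi₀≡c)

  pillarOf : ∀ {i c} → ψ i ≡ just c → Fin m
  pillarOf {i} {c} ψi≡c = proj₁ (proj₁ assignment i c ψi≡c)

  pillarOf-assigned : ∀ {i c} (ψi≡c : ψ i ≡ just c) → Asg (pillarOf ψi≡c) i
  pillarOf-assigned {i} {c} ψi≡c = proj₂ (proj₁ assignment i c ψi≡c)

  record Item : Set where
    field
      interval : Fin n
      pillar   : Fin m
      colour   : ℕ
      assigned : Asg pillar interval
      coloured : ψ interval ≡ just colour
      meetsK   : InK interval
  open Item public

  end : Item → ℚ
  end x = endpoint (pillar x) (𝓘 (interval x))

  keyOrder : StrictTotalOrder _ _ _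
  keyOrder = ×-strictTotalOrder pillarOrder ℕ.<-strictTotalOrder

  open StrictTotalOrder keyOrder public using () renaming (_<_ to _⊏ₖ_)

  key : Item → (Bool × ℚ) × ℕ
  key x = pillarKey (pillar x) , colour x

  _⋖_ : Item → Item → Set
  x ⋖ y = end x < end y × key x ⊏ₖ key y

  ⋖-trans : ∀ {x y z} → x ⋖ y → y ⋖ z → x ⋖ z
  ⋖-trans (e<e′ , k⊏k′) (e′<e″ , k′⊏k″) =
    ℚ.<-trans e<e′ e′<e″ , StrictTotalOrder.trans keyOrder k⊏k′ k′⊏k″

  Overlapping : Fin n → Fin n → Set
  Overlapping i j = Overlap (𝓘 i) (𝓘 j)

  private
    ⋖-samePillar : ∀ {x y} → pillar x ≡ pillar y → x ⋖ y → colour x ℕ.< colour y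
    ⋖-samePillar {x} same (_ , inj₁ x⊏y) = contradiction
      (subst (λ k → pillarKey (pillar x) ⊏ pillarKey k) (sym same) x⊏y)
      (StrictTotalOrder.irrefl pillarOrder (refl , refl))
    ⋖-samePillar same (_ , inj₂ (_ , c<c′)) = c<c′

    ⋖-otherPillar : ∀ {x y} → pillar x ≢ pillar y → x ⋖ y → pillarKey (pillar x) ⊏ pillarKey (pillar y)
    ⋖-otherPillar _     (_ , inj₁ x⊏y)               = x⊏y
    ⋖-otherPillar other (_ , inj₂ ((_ , P≡P′) , _)) = contradiction (P-injective P≡P′) other

  group-clique : ∀ g gs → All (λ x → pillar x ≡ pillar g) gs → AllPairs _⋖_ (g ∷ gs) →
    ∃ λ is → length is ≡ length (g ∷ gs) × AllPairs Overlapping is ×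
             All (λ i → Asg (pillar g) i × InK i × end g ≤ endpoint (pillar g) (𝓘 i) ×
                        ∃ λ y → y ∈ g ∷ gs × endpoint (pillar g) (𝓘 i) ≤ end y) is
  group-clique g gs same chain =
    let is , len , overlapping , bounds =
          structured-clique 𝓘 {e = endpoint k} {X = Asg k} (structured-endpoint k)
                            interval colour g gs valid increasing
    in is , len , overlapping , All.map refine bounds
    where
    k = pillar g
    at-k : All (λ x → pillar x ≡ k) (g ∷ gs)
    at-k = refl ∷ same
    end≡ : ∀ {x} → pillar x ≡ k → end x ≡ endpoint k (𝓘 (interval x))
    end≡ {x} = cong (λ k → endpoint k (𝓘 (interval x)))
    valid : All (λ x → Asg k (interval x) × ψ (interval x) ≡ just (colour x)) (g ∷ gs)
    valid = All.map (λ {x} x-at-k → subst (λ k → Asg k (interval x)) x-at-k (assigned x) , coloured x) at-k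
    increasing : AllPairs (λ x y → colour x ℕ.< colour y ×
                                   endpoint k (𝓘 (interval x)) < endpoint k (𝓘 (interval y))) (g ∷ gs)
    increasing = AllPairs-mapWithAll (λ {x} {y} x-at-k y-at-k x⋖y →
      ⋖-samePillar {x} {y} (trans x-at-k (sym y-at-k)) x⋖y ,
      subst₂ _<_ (end≡ {x} x-at-k) (end≡ {y} y-at-k) (proj₁ x⋖y)) at-k chain
    refine : ∀ {i} → Asg k i × end g ≤ endpoint k (𝓘 i) ×
                     (∃ λ y → y ∈ g ∷ gs × endpoint k (𝓘 i) ≤ endpoint k (𝓘 (interval y))) →
                     Asg k i × InK i × end g ≤ endpoint k (𝓘 i) ×
                     ∃ λ y → y ∈ g ∷ gs × endpoint k (𝓘 i) ≤ end y
    refine {i} (asg , g≤i , y , y∈ , i≤y) =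
      asg , endpoint-∈K⇒InK k i (ℚ.<-≤-trans (proj₁ (endpoint-∈K (assigned g) (meetsK g))) g≤i ,
                                 ℚ.≤-<-trans i≤y′ (proj₂ (endpoint-∈K (assigned y) (meetsK y)))) ,
      g≤i , y , y∈ , i≤y′
      where
      i≤y′ = subst (endpoint k (𝓘 i) ≤_) (sym (end≡ {y} (All.lookup at-k y∈))) i≤y

  Beyond : Item → Fin n → Set
  Beyond x i = ∃ λ k → Asg k i × InK i × (pillar x ≡ k ⊎ pillarKey (pillar x) ⊏ pillarKey k) ×
                       end x ≤ endpoint k (𝓘 i)

  private
    beyond-strictly : ∀ {g r i u} → pillarKey (pillar g) ⊏ pillarKey (pillar r) → u < end r → Beyond r i →
                      ∃ λ k → Asg k i × InK i × pillarKey (pillar g) ⊏ pillarKey k × u < endpoint k (𝓘 i)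
    beyond-strictly g⊏r u<r (k , asg , i∩K , r⊑k , r≤i) =
      k , asg , i∩K , [ (λ { refl → g⊏r }) , StrictTotalOrder.trans pillarOrder g⊏r ]′ r⊑k ,
      ℚ.<-≤-trans u<r r≤i

    Overlapping-across : ∀ {g r i j ys} → pillarKey (pillar g) ⊏ pillarKey (pillar r) → All (_⋖ r) ys →
                         Asg (pillar g) i → InK i → (∃ λ y → y ∈ ys × endpoint (pillar g) (𝓘 i) ≤ end y) →
                         Beyond r j → Overlapping i j
    Overlapping-across {g} {r} g⊏r ys⋖r asg i∩K (y , y∈ , i≤y) r-j =
      let k , asg′ , j∩K , g⊏k , y<j = beyond-strictly {g} {r} g⊏r (proj₁ (All.lookup ys⋖r y∈)) r-j
      in ordered⇒Overlap asg i∩K asg′ j∩K g⊏k (ℚ.≤-<-trans i≤y y<j)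

    -- gs accumulates the run of items sharing the pillar of g; each run yields a clique by
    -- group-clique, and the cliques of successive runs overlap by ordered⇒Overlap.
    chain-clique-from : ∀ g gs rest → All (λ x → pillar x ≡ pillar g) gs →
                        AllPairs _⋖_ ((g ∷ gs) ++ rest) →
      ∃ λ is → length is ≡ length ((g ∷ gs) ++ rest) × AllPairs Overlapping is × All (Beyond g) is
    chain-clique-from g gs [] same chain rewrite ++-identityʳ gs =
      let is , len , overlapping , bounds = group-clique g gs same chain
      in is , len , overlapping ,
         All.map (λ (asg , i∩K , g≤i , _) → pillar g , asg , i∩K , inj₁ refl , g≤i) bounds
    chain-clique-from g gs (r ∷ rest) same chain with pillar r Fin.≟ pillar g
    ... | yes r≡g rewrite sym (++-assoc gs (r ∷ []) rest) =
      chain-clique-from g (gs ++ r ∷ []) rest (All.++⁺ same (r≡g ∷ [])) chain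
    ... | no r≢g =
      let run-chain , across , rest-chain = AllPairs-++⁻ (g ∷ gs) chain
          gis , glen , goverlapping , gbounds = group-clique g gs same run-chain
          ris , rlen , roverlapping , rbeyond = chain-clique-from r [] rest [] rest-chain
          g⋖r = All.head (All.head across)
          g⊏r = ⋖-otherPillar {g} {r} (r≢g ∘ sym) g⋖r
      in gis ++ ris ,
         trans (length-++ gis) (trans (cong₂ ℕ._+_ glen rlen) (sym (length-++ (g ∷ gs)))) ,
         AllPairs.++⁺ goverlapping roverlapping
           (All.map (λ (asg , i∩K , _ , i≤run) →
              All.map (Overlapping-across {g} {r} g⊏r (All.map All.head across) asg i∩K i≤run) rbeyond)
            gbounds) ,
         All.++⁺ (All.map (λ (asg , i∩K , g≤i , _) → pillar g , asg , i∩K , inj₁ refl , g≤i) gbounds)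
                 (All.map (λ r-j → let k , asg , j∩K , g⊏k , g<j = beyond-strictly {g} {r} g⊏r (proj₁ g⋖r) r-j
                                   in k , asg , j∩K , inj₂ g⊏k , ℚ.<⇒≤ g<j) rbeyond)

  chain⇒clique : ∀ xs → AllPairs _⋖_ xs → ∃ λ is → length is ≡ length xs × AllPairs Overlapping is
  chain⇒clique [] _ = [] , refl , []
  chain⇒clique (x ∷ xs) chain =
    let is , len , overlapping , _ = chain-clique-from x [] xs [] chain in is , len , overlapping

  private
    module Degree {J d} (deg : HasDegree 𝓘 ψ J d) where
      colours : List ℕ
      colours = proj₁ deg

      colours-unique : Unique colours
      colours-unique = proj₁ (proj₂ deg)

      ∈colours⁻ : ∀ {c} → c ∈ colours → ∃ λ i → ψ i ≡ just c × HasEndpointIn J (𝓘 i)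
      ∈colours⁻ = proj₁ (proj₂ (proj₂ deg)) _

      ∈colours⁺ : ∀ {c i} → ψ i ≡ just c → HasEndpointIn J (𝓘 i) → c ∈ colours
      ∈colours⁺ ψi≡c i∩J = proj₁ (proj₂ (proj₂ (proj₂ deg))) _ (_ , ψi≡c , i∩J)

      length-colours : length colours ≡ d
      length-colours = proj₂ (proj₂ (proj₂ (proj₂ deg)))

  module Incidences {dK : ℕ} (degK : HasDegree 𝓘 ψ K dK) {t : ℕ} (𝓙 : Fin t → Interval)
                    (disjoint : ∀ j j′ → j ≢ j′ → Disjointᴵ (𝓙 j) (𝓙 j′)) (𝓙⊆K : ∀ j → 𝓙 j ⊆ᴵ K)
                    {dJ : Fin t → ℕ} (degJ : ∀ j → HasDegree 𝓘 ψ (𝓙 j) (dJ j)) where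

    private
      module DK = Degree {K} degK
      module DJ (j : Fin t) = Degree {𝓙 j} (degJ j)

      keysK : List ((Bool × ℚ) × ℕ)
      keysK = mapWith∈ DK.colours λ {c} c∈ → pillarKey (pillarOf (proj₁ (proj₂ (DK.∈colours⁻ c∈)))) , c

      key∈keysK : ∀ x → key x ∈ keysK
      key∈keysK x =
        let c∈ = DK.∈colours⁺ (coloured x) (meetsK x)
            i , ψi≡c , i∩K = DK.∈colours⁻ c∈
            same = colour-determines-pillar (pillarOf-assigned ψi≡c) i∩K (assigned x) (meetsK x) ψi≡c (coloured x)
        in Any.mapWith∈⁺ _ (colour x , c∈ , cong (λ k → pillarKey k , colour x) (sym same))

      module σ = Rank keyOrder keysK
      module ρ = Rank ℚ.<-strictTotalOrder (map (lo ∘ 𝓙) (allFin t))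

      lo∈ : ∀ j → lo (𝓙 j) ∈ map (lo ∘ 𝓙) (allFin t)
      lo∈ j = ∈-map⁺ (lo ∘ 𝓙) (∈-allFin j)

      ρ-injective : ∀ {j j′} → ρ.rank (lo (𝓙 j)) ≡ ρ.rank (lo (𝓙 j′)) → j ≡ j′
      ρ-injective {j} {j′} eq with j Fin.≟ j′
      ... | yes j≡j′ = j≡j′
      ... | no j≢j′ = contradiction (ρ.rank-injective (lo∈ j) (lo∈ j′) eq)
                                    (Disjointᴵ⇒lo≢ {𝓙 j} {𝓙 j′} (disjoint j j′ j≢j′))

      ρ-ordered : ∀ {j j′ x y} → ρ.rank (lo (𝓙 j)) ℕ.< ρ.rank (lo (𝓙 j′)) →
                  x ∈ᴵ 𝓙 j → y ∈ᴵ 𝓙 j′ → x < y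
      ρ-ordered {j} {j′} ρ<ρ′ with j Fin.≟ j′
      ... | yes refl = contradiction ρ<ρ′ (ℕ.<-irrefl refl)
      ... | no j≢j′ =
        Disjointᴵ-ordered {𝓙 j} {𝓙 j′} (disjoint j j′ j≢j′) (ρ.rank-cancel-< (lo∈ j′) ρ<ρ′)

      item : ∀ j {c} → c ∈ DJ.colours j → Item
      item j c∈ = let i , ψi≡c , i∩J = DJ.∈colours⁻ j c∈ in record
        { interval = i ; pillar = pillarOf ψi≡c ; colour = _ ; assigned = pillarOf-assigned ψi≡c
        ; coloured = ψi≡c ; meetsK = HasEndpointIn-mono {𝓘 i} {𝓙 j} {K} (𝓙⊆K j) i∩J }

      item-end : ∀ j {c} (c∈ : c ∈ DJ.colours j) → end (item j c∈) ∈ᴵ 𝓙 j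
      item-end j c∈ =
        endpoint-∈ {J = 𝓙 j} (assigned (item j c∈)) (𝓙⊆K j) (proj₂ (proj₂ (DJ.∈colours⁻ j c∈)))

    cell : Fin t → Item → Cell
    cell j x = ρ.rank (lo (𝓙 j)) , σ.rank (key x)

    private
      row : Fin t → List Cell
      row j = mapWith∈ (DJ.colours j) (cell j ∘ item j)

    cells : List Cell
    cells = concat (map row (allFin t))

    ∈cells⁻ : ∀ {v} → v ∈ cells → ∃ λ j → ∃ λ x → end x ∈ᴵ 𝓙 j × v ≡ cell j x
    ∈cells⁻ v∈ with cs , v∈cs , cs∈ ← ∈-concat⁻′ (map row (allFin t)) v∈
               with j , _ , refl ← ∈-map⁻ row cs∈
               with c , c∈ , v≡ ← Any.mapWith∈⁻ (DJ.colours j) (cell j ∘ item j) v∈cs =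
      j , item j c∈ , item-end j c∈ , v≡

    length-cells : length cells ≡ sumFin dJ
    length-cells = begin
      length (concat (map row (allFin t)))   ≡⟨ length-concat (map row (allFin t)) ⟩
      sum (map length (map row (allFin t)))  ≡⟨ cong sum (map-∘ (allFin t)) ⟨
      sum (map (length ∘ row) (allFin t))    ≡⟨ cong sum (map-cong row-length (allFin t)) ⟩
      sum (map dJ (allFin t))                ∎
      where
      open ≡-Reasoning
      row-length : ∀ j → length (row j) ≡ dJ j
      row-length j = trans (length-mapWith∈ (setoid _) (DJ.colours j)) (DJ.length-colours j)

    cells-unique : Unique cells
    cells-unique = Unique.concat⁺ (All.map⁺ (All.tabulate λ {j} _ → row-unique j))
                                  (AllPairs.map⁺ (AllPairs.map rows-disjoint (Unique.allFin⁺ t)))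
      where
      row-unique : ∀ j → Unique (row j)
      row-unique j = Unique-mapWith∈ (cell j ∘ item j) (DJ.colours-unique j) λ c∈ c′∈ eq →
        proj₂ (σ.rank-injective (key∈keysK (item j c∈)) (key∈keysK (item j c′∈)) (cong proj₂ eq))
      rows-disjoint : ∀ {j j′} → j ≢ j′ → Disjoint (row j) (row j′)
      rows-disjoint {j} {j′} j≢j′ (v∈ , v∈′)
        with _ , _ , v≡  ← Any.mapWith∈⁻ (DJ.colours j) (cell j ∘ item j) v∈
        with _ , _ , v≡′ ← Any.mapWith∈⁻ (DJ.colours j′) (cell j′ ∘ item j′) v∈′ =
        j≢j′ (ρ-injective (cong proj₁ (trans (sym v≡) v≡′)))

    cells-inBox : ∀ {v} → v ∈ cells → InBox 0 t 0 dK v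
    cells-inBox v∈ with j , x , _ , refl ← ∈cells⁻ v∈ = (ℕ.z≤n , ρ<t) , (ℕ.z≤n , σ<dK)
      where
      ρ<t : ρ.rank (lo (𝓙 j)) ℕ.< t
      ρ<t = subst (ρ.rank (lo (𝓙 j)) ℕ.<_)
                  (trans (length-map (lo ∘ 𝓙) (allFin t)) (length-tabulate {n = t} id))
                  (ρ.rank<length (lo∈ j))
      σ<dK : σ.rank (key x) ℕ.< dK
      σ<dK = subst (σ.rank (key x) ℕ.<_) (trans (length-mapWith∈ (setoid _) DK.colours) DK.length-colours)
                   (σ.rank<length (key∈keysK x))

    cells-chainFree : ∀ {ω} → IsOmega 𝓘 (λ _ → ⊤) ω → ChainFree (ℕ.suc ω) cells
    cells-chainFree {ω} omega ch len ch⊆cells chain =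
      let is , len′ , overlapping = chain⇒clique items (Linked⇒AllPairs (λ {x} {y} {z} → ⋖-trans {x} {y} {z})
                                                         (Linked-mapWith∈ decode decode-mono chain))
      in ℕ.<-irrefl refl (subst (ℕ._≤ ω) (trans len′ (trans (length-mapWith∈ (setoid _) ch) len))
                                (proj₂ omega is (All.universal _ is , overlapping)))
      where
      decode : ∀ {v} → v ∈ ch → Item
      decode v∈ = proj₁ (proj₂ (∈cells⁻ (ch⊆cells v∈)))
      items = mapWith∈ ch decode
      decode-mono : ∀ {v w} (v∈ : v ∈ ch) (w∈ : w ∈ ch) → v ≺ w → decode v∈ ⋖ decode w∈
      decode-mono v∈ w∈ with ∈cells⁻ (ch⊆cells v∈) | ∈cells⁻ (ch⊆cells w∈)
      ... | j , x , x∈J , refl | j′ , y , y∈J′ , refl = λ (ρ<ρ′ , σ<σ′) →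
        ρ-ordered ρ<ρ′ x∈J y∈J′ , σ.rank-cancel-< (key∈keysK y) σ<σ′

open import Data.Nat using (_≤_; _+_; _*_; _∸_)
open import Data.Product using (_×_)
open import Data.Unit using (⊤)
open import Data.Empty using (⊥)
open import Relation.Binary.PropositionalEquality using (_≢_; cong)
open import Data.Nat.Properties using (+-comm; module ≤-Reasoning)
open import Data.List.Base using (length)
open Grid using (chainFree-length≤)

lemma10 : ∀ {n m : ℕ} (𝓘 : Fin n → Interval) → IsIntervalSystem 𝓘 →
          (P : Fin m → ℚ) → IsPillarSet 𝓘 P →
          (ψ : Fin n → Maybe ℕ) → IsPillarAssignment 𝓘 P ψ →
          (ω : ℕ) → IsOmega 𝓘 (λ _ → ⊤) ω →
          (K : Interval) → IsArch 𝓘 P (lo K) (hi K) →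
          (dK : ℕ) → HasDegree 𝓘 ψ K dK → ω ≤ dK →
          (t : ℕ) (𝓙 : Fin t → Interval) →
          (∀ j j' → j ≢ j' → (x : ℚ) → x ∈ᴵ 𝓙 j → x ∈ᴵ 𝓙 j' → ⊥) →
          (∀ j → 𝓙 j ⊆ᴵ K) → ω ≤ t →
          (dJ : Fin t → ℕ) → (∀ j → HasDegree 𝓘 ψ (𝓙 j) (dJ j)) →
          sumFin dJ ≤ ω * (dK + t ∸ ω)
lemma10 𝓘 _ P pillars ψ assignment ω omega K arch dK degK ω≤dK t 𝓙 disjoint 𝓙⊆K ω≤t dJ degJ = begin
  sumFin dJ         ≡⟨ length-cells ⟨
  length cells      ≤⟨ chainFree-length≤ ω cells cells-unique cells-inBox (cells-chainFree omega)
                                         ω≤t ω≤dK ⟩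
  ω * (t + dK ∸ ω)  ≡⟨ cong (λ s → ω * (s ∸ ω)) (+-comm t dK) ⟩
  ω * (dK + t ∸ ω)  ∎
  where
  open ≤-Reasoning
  open Arch 𝓘 P pillars ψ assignment K arch
  open Incidences degK 𝓙 disjoint 𝓙⊆K degJ
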